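{- Let $T=\langle\Gamma\rangle\Rightarrow\alpha$ be a $\mathcal{C}$-type, with $\Gamma\in\mathcal{C}$ and $\alpha\in\mathcal{A}$. If $T$ is finally closed, then $FO(\alpha,\Gamma)\neq\emptyset$. If $T$ is moreover closed, then $FO(\alpha,\Gamma)$ has exactly one element $(i,v)$, and $v=(\varphi_1\to\cdots\to\varphi_m\to\alpha)\wedge v'$ for some $m\ge0$, some $\varphi_1,\dots,\varphi_m$ and some $v'$ with $\alpha\notin TV(v')$.
   Context: Types: $\mathcal{A}$ a denumerable set of type variables; $\tau\in\mathcal{T}::=\alpha\mid u\to\tau$, $u\in\mathcal{U}::=\omega\mid u\wedge u\mid\tau$, $\wedge$ commutative, associative, neutral element $\omega$; $\to$ right-associative. Contexts $\Gamma::=nil\mid u.\Gamma$; $\Gamma_i$ is the $i$-th element, $|\Gamma|$ the length. Subsets: $\rho\in\mathcal{T}_C::=\alpha\mid\varphi\to\rho$ ($\varphi\in\mathcal{T}_{NF}$); $\varphi\in\mathcal{T}_{NF}::=\alpha\mid v\to\varphi$ ($v\in\mathcal{U}_C$); $v\in\mathcal{U}_C::=\omega\mid v\wedge v\mid\rho$; $\mathcal{C}$: contexts with all elements in $\mathcal{U}_C$. $TV(\cdot)$: type variables occurring. A $\mathcal{C}$-type is $\langle\Gamma\rangle\Rightarrow\varphi$ ($\Gamma\in\mathcal{C}$, $\varphi\in\mathcal{T}_{NF}$) or $\langle\Delta\rangle\Rightarrow$ ($\Delta\in\mathcal{C}$, $|\Delta|>0$). Polarity: $\alpha$ positive in $\alpha$;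 in $u\to\tau$ occurrences in $\tau$ keep sign, in $u$ reversed; $\wedge$ and context elements keep signs; in $\langle\Gamma\rangle\Rightarrow\varphi$ occurrences in $\varphi$ keep sign, in $\Gamma$ reversed. Closed: every type variable of $T$ has exactly one positive and one negative occurrence in $T$. Final occurrence: of $\alpha$ is $\alpha$, of $u\to\tau$ that of $\tau$; the final occurrences of $\tau_1\wedge\cdots\wedge\tau_k$ are those of the $\tau_j$. Left subtypes: $L(\langle\Gamma\rangle\Rightarrow\varphi)=L(\Gamma)\cup L(\varphi)$, $L(v.\Gamma)=\{v\}\cup L(\Gamma)$ if $v\ne\omega$ else $L(\Gamma)$, $L(nil)=\emptyset$, $L(v\to\varphi)=\{v\}\cup L(\varphi)$ if $v\neq\omega$ else $L(\varphi)$, $L(\alpha)=\emptyset$. $T=\langle\Gamma\rangle\Rightarrow\varphi$ is finally closed if the final occurrence of $\varphi$ is also the final occurrence of some type in $L(T)$. For a context $\Gamma$, $FO(\alpha,\Gamma)=\{(i,\Gamma_i)\mid 1\le i\le|\Gamma|,\ \alpha\text{ is a final occurrence of }\Gamma_i\}$. -}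

module Defs where

open import Data.Nat using (ℕ; zero; suc; _+_; _≟_; _<_)
open import Data.List using (List; []; _∷_; _++_; map; length; foldr)
open import Data.List.Membership.Propositional using (_∈_)
open import Data.Product using (Σ; ∃; _×_; _,_)
open import Relation.Nullary using (yes; no)
open import Relation.Binary.PropositionalEquality using (_≡_)

TVar : Set
TVar = ℕ

-- An element of 𝒰_C (ω | v ∧ v | ρ, ∧ ACU) is a finite multiset of ρ's,
-- represented as a list (ω = [], ∧ = _++_); equality of such intersections
-- is taken up to permutation (_↭_).
mutual
  data TC : Set where
    tvar : TVar → TC
    _⇒_  : TNF → TC → TC

  data TNF : Set where
    nvar : TVar → TNF
    _⇒_  : List TC → TNF → TNF

UC : Set
UC = List TC

Ctx : Set
Ctx = List UC

data CType : Set where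
  ⟨_⟩⇒_ : Ctx → TNF → CType
  ⟨_⟩⇒∙ : (Δ : Ctx) → 0 < length Δ → CType

eqv : TVar → TVar → ℕ
eqv β γ with β ≟ γ
... | yes _ = 1
... | no _  = 0

mutual
  posC : TVar → TC → ℕ
  posC β (tvar γ) = eqv β γ
  posC β (φ ⇒ ρ)  = negNF β φ + posC β ρ

  negC : TVar → TC → ℕ
  negC β (tvar γ) = 0
  negC β (φ ⇒ ρ)  = posNF β φ + negC β ρ

  posNF : TVar → TNF → ℕ
  posNF β (nvar γ) = eqv β γ
  posNF β (v ⇒ φ)  = negU β v + posNF β φ

  negNF : TVar → TNF → ℕ
  negNF β (nvar γ) = 0
  negNF β (v ⇒ φ)  = posU β v + negNF β φ

  posU : TVar → UC → ℕ
  posU β []      = 0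
  posU β (ρ ∷ v) = posC β ρ + posU β v

  negU : TVar → UC → ℕ
  negU β []      = 0
  negU β (ρ ∷ v) = negC β ρ + negU β v

posCtx : TVar → Ctx → ℕ
posCtx β []      = 0
posCtx β (v ∷ Γ) = posU β v + posCtx β Γ

negCtx : TVar → Ctx → ℕ
negCtx β []      = 0
negCtx β (v ∷ Γ) = negU β v + negCtx β Γ

posT : TVar → CType → ℕ
posT β (⟨ Γ ⟩⇒ φ)  = negCtx β Γ + posNF β φ
posT β (⟨ Δ ⟩⇒∙ _) = negCtx β Δ

negT : TVar → CType → ℕ
negT β (⟨ Γ ⟩⇒ φ)  = posCtx β Γ + negNF β φ
negT β (⟨ Δ ⟩⇒∙ _) = posCtx β Δ

mutual
  tvC : TC → List TVar
  tvC (tvar γ) = γ ∷ []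
  tvC (φ ⇒ ρ)  = tvNF φ ++ tvC ρ

  tvNF : TNF → List TVar
  tvNF (nvar γ) = γ ∷ []
  tvNF (v ⇒ φ)  = tvU v ++ tvNF φ

  tvU : UC → List TVar
  tvU []      = []
  tvU (ρ ∷ v) = tvC ρ ++ tvU v

tvCtx : Ctx → List TVar
tvCtx []      = []
tvCtx (v ∷ Γ) = tvU v ++ tvCtx Γ

tvT : CType → List TVar
tvT (⟨ Γ ⟩⇒ φ)  = tvCtx Γ ++ tvNF φ
tvT (⟨ Δ ⟩⇒∙ _) = tvCtx Δ

Closed : CType → Set
Closed T = ∀ β → β ∈ tvT T → posT β T ≡ 1 × negT β T ≡ 1

finalC : TC → TVar
finalC (tvar γ) = γ
finalC (φ ⇒ ρ)  = finalC ρ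

finalNF : TNF → TVar
finalNF (nvar γ) = γ
finalNF (v ⇒ φ)  = finalNF φ

finalsU : UC → List TVar
finalsU v = map finalC v

nonω : UC → List UC
nonω []      = []
nonω (ρ ∷ v) = (ρ ∷ v) ∷ []

LCtx : Ctx → List UC
LCtx []      = []
LCtx (v ∷ Γ) = nonω v ++ LCtx Γ

LNF : TNF → List UC
LNF (nvar γ) = []
LNF (v ⇒ φ)  = nonω v ++ LNF φ

L : Ctx → TNF → List UC
L Γ φ = LCtx Γ ++ LNF φ

FinallyClosed : Ctx → TNF → Set
FinallyClosed Γ φ = Σ UC λ v → v ∈ L Γ φ × finalNF φ ∈ finalsU v

arrows : List TNF → TVar → TC
arrows []       α = tvar α
arrows (φ ∷ φs) α = φ ⇒ arrows φs α

-- The left subtypes of ⟨Γ⟩ ⇒ α are the non-ω entries of Γ, so finally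
-- closedness yields an entry Γᵢ with a conjunct whose final occurrence is α,
-- i.e. a conjunct φ₁ → ⋯ → φₘ → α; that occurrence of α is positive in Γ.
-- If T is closed, its only positive occurrence of α is the one on the right,
-- so α is never negative in Γ, and its only negative occurrence is the one
-- in Γ, so α is positive in Γ exactly once.  Hence Γᵢ is unique, and the
-- remaining conjuncts v′ contain α neither positively nor negatively.
module Submission where

open import Defs
open import Data.Nat using (_+_; _≤_; z≤n; s≤s; _≟_)
open import Data.Nat.ListAction using (sum)
open import Data.Nat.ListAction.Properties using (sum-↭)
open import Data.Nat.Properties
  using (m+n≡0⇒m≡0; m+n≡0⇒n≡0; m≤m+n; m≤n+m; ≤-trans; +-mono-≤; +-monoˡ-≤;
         +-cancelˡ-≤; +-cancelʳ-≡; +-identityʳ; n≤0⇒n≡0)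
open import Data.Fin using (Fin; zero; suc)
open import Data.List using (List; []; _∷_; _++_; length; lookup; map)
open import Data.List.Membership.Propositional using (_∈_; _∉_)
open import Data.List.Membership.Propositional.Properties using (∈-map⁻; ∈-++⁻; ∈-++⁺ʳ; ∈-∃++)
open import Data.List.Relation.Unary.Any using (here; there; index)
open import Data.List.Relation.Unary.Any.Properties using (lookup-index)
open import Data.List.Relation.Binary.Permutation.Propositional using (_↭_)
open import Data.List.Relation.Binary.Permutation.Propositional.Properties using (shift; map⁺)
open import Data.Product using (Σ; _×_; _,_)
open import Data.Sum using (inj₁; inj₂)
open import Data.Empty using (⊥-elim)
open import Relation.Nullary using (yes; no)
open import Relation.Binary.PropositionalEquality using (_≡_; _≢_; refl; sym; trans; cong; subst)
open Relation.Binary.PropositionalEquality.≡-Reasoning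

eqv-refl : ∀ β → eqv β β ≡ 1
eqv-refl β with β ≟ β
... | yes _  = refl
... | no β≢β = ⊥-elim (β≢β refl)

eqv≡0⇒≢ : ∀ β γ → eqv β γ ≡ 0 → β ≢ γ
eqv≡0⇒≢ β .β e refl with trans (sym (eqv-refl β)) e
... | ()

mutual
  posC≡0⇒negC≡0⇒∉tvC : ∀ β ρ → posC β ρ ≡ 0 → negC β ρ ≡ 0 → β ∉ tvC ρ
  posC≡0⇒negC≡0⇒∉tvC β (tvar γ) p n (here β≡γ) = eqv≡0⇒≢ β γ p β≡γ
  posC≡0⇒negC≡0⇒∉tvC β (φ ⇒ ρ)  p n β∈ with ∈-++⁻ (tvNF φ) β∈
  ... | inj₁ β∈φ = posNF≡0⇒negNF≡0⇒∉tvNF β φ (m+n≡0⇒m≡0 _ n) (m+n≡0⇒m≡0 _ p) β∈φ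
  ... | inj₂ β∈ρ = posC≡0⇒negC≡0⇒∉tvC β ρ (m+n≡0⇒n≡0 _ p) (m+n≡0⇒n≡0 _ n) β∈ρ

  posNF≡0⇒negNF≡0⇒∉tvNF : ∀ β φ → posNF β φ ≡ 0 → negNF β φ ≡ 0 → β ∉ tvNF φ
  posNF≡0⇒negNF≡0⇒∉tvNF β (nvar γ) p n (here β≡γ) = eqv≡0⇒≢ β γ p β≡γ
  posNF≡0⇒negNF≡0⇒∉tvNF β (v ⇒ φ)  p n β∈ with ∈-++⁻ (tvU v) β∈
  ... | inj₁ β∈v = posU≡0⇒negU≡0⇒∉tvU β v (m+n≡0⇒m≡0 _ n) (m+n≡0⇒m≡0 _ p) β∈v
  ... | inj₂ β∈φ = posNF≡0⇒negNF≡0⇒∉tvNF β φ (m+n≡0⇒n≡0 _ p) (m+n≡0⇒n≡0 _ n) β∈φ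

  posU≡0⇒negU≡0⇒∉tvU : ∀ β v → posU β v ≡ 0 → negU β v ≡ 0 → β ∉ tvU v
  posU≡0⇒negU≡0⇒∉tvU β (ρ ∷ v) p n β∈ with ∈-++⁻ (tvC ρ) β∈
  ... | inj₁ β∈ρ = posC≡0⇒negC≡0⇒∉tvC β ρ (m+n≡0⇒m≡0 _ p) (m+n≡0⇒m≡0 _ n) β∈ρ
  ... | inj₂ β∈v = posU≡0⇒negU≡0⇒∉tvU β v (m+n≡0⇒n≡0 _ p) (m+n≡0⇒n≡0 _ n) β∈v

posU≡sum : ∀ β v → posU β v ≡ sum (map (posC β) v)
posU≡sum β []      = refl
posU≡sum β (ρ ∷ v) = cong (posC β ρ +_) (posU≡sum β v)

negU≡sum : ∀ β v → negU β v ≡ sum (map (negC β) v)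
negU≡sum β []      = refl
negU≡sum β (ρ ∷ v) = cong (negC β ρ +_) (negU≡sum β v)

posU-↭ : ∀ β {v w} → v ↭ w → posU β v ≡ posU β w
posU-↭ β {v} {w} v↭w = begin
  posU β v                ≡⟨ posU≡sum β v ⟩
  sum (map (posC β) v)    ≡⟨ sum-↭ (map⁺ (posC β) v↭w) ⟩
  sum (map (posC β) w)    ≡⟨ sym (posU≡sum β w) ⟩
  posU β w                ∎

negU-↭ : ∀ β {v w} → v ↭ w → negU β v ≡ negU β w
negU-↭ β {v} {w} v↭w = begin
  negU β v                ≡⟨ negU≡sum β v ⟩
  sum (map (negC β) v)    ≡⟨ sum-↭ (map⁺ (negC β) v↭w) ⟩
  sum (map (negC β) w)    ≡⟨ sym (negU≡sum β w) ⟩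
  negU β w                ∎

∈⇒↭∷ : ∀ {A : Set} {x : A} {xs : List A} → x ∈ xs → Σ (List A) λ ys → xs ↭ x ∷ ys
∈⇒↭∷ {x = x} x∈xs with ∈-∃++ x∈xs
... | ys , zs , refl = ys ++ zs , shift x ys zs

finalC≡⇒arrows : ∀ α ρ → α ≡ finalC ρ → Σ (List TNF) λ φs → ρ ≡ arrows φs α
finalC≡⇒arrows α (tvar γ) refl = [] , refl
finalC≡⇒arrows α (φ ⇒ ρ)  α≡ with finalC≡⇒arrows α ρ α≡
... | φs , ρ≡ = φ ∷ φs , cong (φ ⇒_) ρ≡

1≤posC-arrows : ∀ α φs → 1 ≤ posC α (arrows φs α)
1≤posC-arrows α []       rewrite eqv-refl α = s≤s z≤n
1≤posC-arrows α (φ ∷ φs) = ≤-trans (1≤posC-arrows α φs) (m≤n+m _ (negNF α φ))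

∈finalsU⇒↭arrows : ∀ α v → α ∈ finalsU v →
  Σ (List TNF) λ φs → Σ UC λ v′ → v ↭ (arrows φs α ∷ v′)
∈finalsU⇒↭arrows α v α∈ with ∈-map⁻ finalC α∈
... | ρ , ρ∈v , α≡ with ∈⇒↭∷ ρ∈v | finalC≡⇒arrows α ρ α≡
... | v′ , v↭ | φs , refl = φs , v′ , v↭

∈finalsU⇒1≤posU : ∀ α v → α ∈ finalsU v → 1 ≤ posU α v
∈finalsU⇒1≤posU α v α∈ with ∈finalsU⇒↭arrows α v α∈
... | φs , v′ , v↭ =
  subst (1 ≤_) (sym (posU-↭ α v↭)) (≤-trans (1≤posC-arrows α φs) (m≤m+n _ _))

1≤m⇒m+n≤1⇒n≡0 : ∀ {m n} → 1 ≤ m → m + n ≤ 1 → n ≡ 0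
1≤m⇒m+n≤1⇒n≡0 {n = n} 1≤m m+n≤1 =
  n≤0⇒n≡0 (+-cancelˡ-≤ 1 n 0 (≤-trans (+-monoˡ-≤ n 1≤m) m+n≤1))

∉tvU-rest : ∀ α φs {v v′} → v ↭ (arrows φs α ∷ v′) →
  posU α v ≤ 1 → negU α v ≡ 0 → α ∉ tvU v′
∉tvU-rest α φs {v} {v′} v↭ pos≤1 neg≡0 = posU≡0⇒negU≡0⇒∉tvU α v′ pos′≡0 neg′≡0
  where
  pos′≡0 : posU α v′ ≡ 0
  pos′≡0 = 1≤m⇒m+n≤1⇒n≡0 (1≤posC-arrows α φs) (subst (_≤ 1) (posU-↭ α v↭) pos≤1)

  neg′≡0 : negU α v′ ≡ 0
  neg′≡0 = m+n≡0⇒n≡0 (negC α (arrows φs α)) (trans (sym (negU-↭ α v↭)) neg≡0)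

∈LCtx⇒∈ : ∀ Γ {v} → v ∈ LCtx Γ → v ∈ Γ
∈LCtx⇒∈ ([] ∷ Γ)       v∈          = there (∈LCtx⇒∈ Γ v∈)
∈LCtx⇒∈ ((ρ ∷ w) ∷ Γ) (here refl) = here refl
∈LCtx⇒∈ ((ρ ∷ w) ∷ Γ) (there v∈)  = there (∈LCtx⇒∈ Γ v∈)

finallyClosed⇒∈finalsU : ∀ Γ α → FinallyClosed Γ (nvar α) →
  Σ (Fin (length Γ)) λ i → α ∈ finalsU (lookup Γ i)
finallyClosed⇒∈finalsU Γ α (v , v∈L , α∈) with ∈-++⁻ (LCtx Γ) v∈L
... | inj₁ v∈LΓ = index v∈Γ , subst (λ w → α ∈ finalsU w) (lookup-index v∈Γ) α∈
  where v∈Γ = ∈LCtx⇒∈ Γ v∈LΓ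
... | inj₂ ()

posU-lookup≤posCtx : ∀ β Γ i → posU β (lookup Γ i) ≤ posCtx β Γ
posU-lookup≤posCtx β (v ∷ Γ) zero    = m≤m+n _ _
posU-lookup≤posCtx β (v ∷ Γ) (suc i) = ≤-trans (posU-lookup≤posCtx β Γ i) (m≤n+m _ _)

negU-lookup≤negCtx : ∀ β Γ i → negU β (lookup Γ i) ≤ negCtx β Γ
negU-lookup≤negCtx β (v ∷ Γ) zero    = m≤m+n _ _
negU-lookup≤negCtx β (v ∷ Γ) (suc i) = ≤-trans (negU-lookup≤negCtx β Γ i) (m≤n+m _ _)

posCtx≤1⇒positive-unique : ∀ β Γ (i j : Fin (length Γ)) → posCtx β Γ ≤ 1 →
  1 ≤ posU β (lookup Γ i) → 1 ≤ posU β (lookup Γ j) → j ≡ i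
posCtx≤1⇒positive-unique β (v ∷ Γ) zero    zero    _ _ _ = refl
posCtx≤1⇒positive-unique β (v ∷ Γ) zero    (suc j) ≤1 1≤i 1≤j
  with ≤-trans (+-mono-≤ 1≤i (≤-trans 1≤j (posU-lookup≤posCtx β Γ j))) ≤1
... | s≤s ()
posCtx≤1⇒positive-unique β (v ∷ Γ) (suc i) zero    ≤1 1≤i 1≤j
  with ≤-trans (+-mono-≤ 1≤j (≤-trans 1≤i (posU-lookup≤posCtx β Γ i))) ≤1
... | s≤s ()
posCtx≤1⇒positive-unique β (v ∷ Γ) (suc i) (suc j) ≤1 1≤i 1≤j =
  cong suc (posCtx≤1⇒positive-unique β Γ i j (≤-trans (m≤n+m _ _) ≤1) 1≤i 1≤j)

closed⇒occurrences-in-ctx : ∀ Γ α → Closed (⟨ Γ ⟩⇒ nvar α) →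
  posCtx α Γ ≡ 1 × negCtx α Γ ≡ 0
closed⇒occurrences-in-ctx Γ α closed with closed α (∈-++⁺ʳ (tvCtx Γ) (here refl))
... | posT≡1 , negT≡1 =
  trans (sym (+-identityʳ _)) negT≡1 ,
  +-cancelʳ-≡ 1 _ 0 (trans (cong (negCtx α Γ +_) (sym (eqv-refl α))) posT≡1)

lemma3p23 : (Γ : Ctx) (α : TVar) →
    (FinallyClosed Γ (nvar α) →
      Σ (Fin (length Γ)) λ i → α ∈ finalsU (lookup Γ i))
    ×
    (FinallyClosed Γ (nvar α) → Closed (⟨ Γ ⟩⇒ nvar α) →
      Σ (Fin (length Γ)) λ i →
        α ∈ finalsU (lookup Γ i)
        × (∀ (j : Fin (length Γ)) → α ∈ finalsU (lookup Γ j) → j ≡ i)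
        × Σ (List TNF) λ φs → Σ UC λ v′ →
            (lookup Γ i ↭ (arrows φs α ∷ v′)) × (α ∉ tvU v′))
lemma3p23 Γ α = finallyClosed⇒∈finalsU Γ α , closed-case
  where
  closed-case : FinallyClosed Γ (nvar α) → Closed (⟨ Γ ⟩⇒ nvar α) → _
  closed-case fc closed
    with finallyClosed⇒∈finalsU Γ α fc | closed⇒occurrences-in-ctx Γ α closed
  ... | i , α∈Γᵢ | pos≡1 , neg≡0
    with ∈finalsU⇒↭arrows α (lookup Γ i) α∈Γᵢ
  ... | φs , v′ , Γᵢ↭ = i , α∈Γᵢ , unique , φs , v′ , Γᵢ↭ , α∉v′
    where
    pos≤1 : posCtx α Γ ≤ 1
    pos≤1 = subst (_≤ 1) (sym pos≡1) (s≤s z≤n)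

    unique : ∀ j → α ∈ finalsU (lookup Γ j) → j ≡ i
    unique j α∈Γⱼ = posCtx≤1⇒positive-unique α Γ i j pos≤1
      (∈finalsU⇒1≤posU α _ α∈Γᵢ) (∈finalsU⇒1≤posU α _ α∈Γⱼ)

    α∉v′ : α ∉ tvU v′
    α∉v′ = ∉tvU-rest α φs Γᵢ↭
      (≤-trans (posU-lookup≤posCtx α Γ i) pos≤1)
      (n≤0⇒n≡0 (subst (negU α (lookup Γ i) ≤_) neg≡0 (negU-lookup≤negCtx α Γ i)))
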